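{- For a finite set $A$, partitions $\pi_1,\pi_2,\pi_3$ of $A$, and a latin square $\mathsf{L}\subset X\times Y\times Z$ of order $n$, \[0\le\Lambda(c_{\pi_1},c_{\pi_2},c_{\pi_3})\le n^{ -\operatorname{crank}(\pi_1,\pi_2,\pi_3)}.\]
   Context: A latin square of order $n$ is $\mathsf{L}\subset X\times Y\times Z$ with $|X|=|Y|=|Z|=n$ such that every pair in $X\times Y$, $Y\times Z$, $Z\times X$ lies in exactly one triple. $\mathsf{L}^A$ is the set of $(x,y,z)\in X^A\times Y^A\times Z^A$ with $(x(a),y(a),z(a))\in\mathsf{L}$ for all $a\in A$, and $\Lambda(f,g,h)=\mathbf{E}_{(x,y,z)\in\mathsf{L}^A}f(x)g(y)h(z)$ (note $|\mathsf{L}^A|=n^{2|A|}$). For a partition $\pi$ of $A$, $c_\pi$ is the indicator function (on $X^A$, $Y^A$ or $Z^A$ as appropriate) of the set of maps that are constant on every cell of $\pi$. For the triple $\psi=(\pi_1,\pi_2,\pi_3)$, consider the disjoint union $\pi_1\sqcup\pi_2\sqcup\pi_3$ of cells labelled by $1,2,3$. A subset $S$ of it is closed if whenever $p_i\in\pi_i$ ($i=1,2,3$) with $p_1\cap p_2\cap p_3\ne\emptyset$ and two of $p_1,p_2,p_3$ lie in $S$, the third also lies in $S$; the closure $\langle S\rangle$ is the intersection of all closed sets containing $S$. The combinatorial rank is $\operatorname{crank}(\psi)=2|A|-\min\{|S|: S\subset\pi_1\sqcup\pi_2\sqcup\pi_3,\ \langle S\rangle=\pi_1\sqcup\pi_2\sqcup\pi_3\}$.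 -}

module Defs where

open import Data.Bool using (Bool; true; false; if_then_else_)
open import Data.Nat as ℕ using (ℕ; zero; suc; NonZero)
open import Data.Nat.Properties using (m^n≢0)
open import Data.Integer as ℤ using (ℤ; +_; -[1+_])
open import Data.Rational as ℚ using (ℚ; _+_; _*_; _/_; 0ℚ; 1ℚ)
open import Data.Fin using (Fin; _≟_)
open import Data.Fin.Properties using (all?)
open import Data.Fin.Subset using (Subset; _∈_; _⊆_; ∣_∣)
open import Data.List using (List; []; _∷_; map; concatMap; foldr)
open import Data.List.Base using (allFin)
open import Data.Vec.Functional as VF using ()
open import Data.Product using (_×_; ∃; ∃!)
open import Relation.Binary.PropositionalEquality using (_≡_)
open import Relation.Nullary using (Dec; does; _→-dec_)

-- Throughout: the finite set A is Fin k, the sets X, Y, Z of the latin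
-- square are (relabelled to) Fin n.

IsLatinSquare : (n : ℕ) → (Fin n → Fin n → Fin n → Bool) → Set
IsLatinSquare n L =
    (∀ x y → ∃! _≡_ (λ z → L x y z ≡ true))
  × (∀ y z → ∃! _≡_ (λ x → L x y z ≡ true))
  × (∀ z x → ∃! _≡_ (λ y → L x y z ≡ true))

-- Partitions of Fin k: a surjective labelling π : Fin k → Fin m; the cells
-- are the fibres π⁻¹(j), j : Fin m (nonempty by surjectivity).

IsPartition : {k m : ℕ} → (Fin k → Fin m) → Set
IsPartition {k} {m} π = ∀ (j : Fin m) → ∃ λ (a : Fin k) → π a ≡ j

allFuns : (n k : ℕ) → List (Fin k → Fin n)
allFuns n zero    = (λ ()) ∷ []
allFuns n (suc k) = concatMap (λ i → map (λ f → i VF.∷ f) (allFuns n k)) (allFin n)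

sumℚ : List ℚ → ℚ
sumℚ = foldr _+_ 0ℚ

allB : (k : ℕ) → (Fin k → Bool) → Bool
allB k p = foldr (λ a b → if p a then b else false) true (allFin k)

InLA : {n k : ℕ} → (Fin n → Fin n → Fin n → Bool) →
       (Fin k → Fin n) → (Fin k → Fin n) → (Fin k → Fin n) → Bool
InLA {n} {k} L x y z = allB k (λ a → L (x a) (y a) (z a))

-- Λ(f,g,h) = E_{(x,y,z) ∈ L^A} f(x) g(y) h(z), with |L^A| = n^{2k}.
Λ : (n k : ℕ) .{{_ : NonZero n}} → (Fin n → Fin n → Fin n → Bool) →
    (f g h : (Fin k → Fin n) → ℚ) → ℚ
Λ n k L f g h =
  sumℚ (concatMap (λ x → concatMap (λ y → map (λ z →
      if InLA L x y z then f x * g y * h z else 0ℚ)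
    (allFuns n k)) (allFuns n k)) (allFuns n k))
  * ((+ 1) / (n ℕ.^ (2 ℕ.* k))) {{m^n≢0 n (2 ℕ.* k)}}

ConstOnCells : {n k m : ℕ} → (Fin k → Fin m) → (Fin k → Fin n) → Set
ConstOnCells π x = ∀ a b → π a ≡ π b → x a ≡ x b

constOnCells? : {n k m : ℕ} (π : Fin k → Fin m) (x : Fin k → Fin n) →
                Dec (ConstOnCells π x)
constOnCells? π x = all? (λ a → all? (λ b → (π a ≟ π b) →-dec (x a ≟ x b)))

c : {n k m : ℕ} → (Fin k → Fin m) → (Fin k → Fin n) → ℚ
c π x = if does (constOnCells? π x) then 1ℚ else 0ℚ

ipow : (n : ℕ) .{{_ : NonZero n}} → ℤ → ℚ
ipow n (+ e)    = (+ (n ℕ.^ e)) / 1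
ipow n -[1+ e ] = ((+ 1) / (n ℕ.^ suc e)) {{m^n≢0 n (suc e)}}

-- A subset of the disjoint union π₁ ⊔ π₂ ⊔ π₃ of
-- cells is a triple of subsets (S₁, S₂, S₃) of the cell-label sets.
-- Three cells p₁, p₂, p₃ have p₁ ∩ p₂ ∩ p₃ ≠ ∅ iff p_i = π_i a for some a.

record CellSubset (m₁ m₂ m₃ : ℕ) : Set where
  constructor ⟨_,_,_⟩
  field
    S₁ : Subset m₁
    S₂ : Subset m₂
    S₃ : Subset m₃
open CellSubset public

size : {m₁ m₂ m₃ : ℕ} → CellSubset m₁ m₂ m₃ → ℕ
size S = ∣ S₁ S ∣ ℕ.+ ∣ S₂ S ∣ ℕ.+ ∣ S₃ S ∣

_⊆c_ : {m₁ m₂ m₃ : ℕ} → CellSubset m₁ m₂ m₃ → CellSubset m₁ m₂ m₃ → Set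
S ⊆c T = (S₁ S ⊆ S₁ T) × (S₂ S ⊆ S₂ T) × (S₃ S ⊆ S₃ T)

IsFull : {m₁ m₂ m₃ : ℕ} → CellSubset m₁ m₂ m₃ → Set
IsFull S = (∀ j → j ∈ S₁ S) × (∀ j → j ∈ S₂ S) × (∀ j → j ∈ S₃ S)

Closed : {k m₁ m₂ m₃ : ℕ} →
         (Fin k → Fin m₁) → (Fin k → Fin m₂) → (Fin k → Fin m₃) →
         CellSubset m₁ m₂ m₃ → Set
Closed π₁ π₂ π₃ C = ∀ a →
    (π₁ a ∈ S₁ C → π₂ a ∈ S₂ C → π₃ a ∈ S₃ C)
  × (π₂ a ∈ S₂ C → π₃ a ∈ S₃ C → π₁ a ∈ S₁ C)
  × (π₃ a ∈ S₃ C → π₁ a ∈ S₁ C → π₂ a ∈ S₂ C)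

-- ⟨S⟩ = whole union: the intersection of all closed supersets of S is
-- everything, i.e. every closed superset of S is everything.
Generates : {k m₁ m₂ m₃ : ℕ} →
            (Fin k → Fin m₁) → (Fin k → Fin m₂) → (Fin k → Fin m₃) →
            CellSubset m₁ m₂ m₃ → Set
Generates π₁ π₂ π₃ S =
  ∀ C → Closed π₁ π₂ π₃ C → S ⊆c C → IsFull C

IsMinGenSize : {k m₁ m₂ m₃ : ℕ} →
               (Fin k → Fin m₁) → (Fin k → Fin m₂) → (Fin k → Fin m₃) →
               ℕ → Set
IsMinGenSize π₁ π₂ π₃ d =
    (∃ λ S → Generates π₁ π₂ π₃ S × size S ≡ d)
  × (∀ S → Generates π₁ π₂ π₃ S → d ℕ.≤ size S)

IsCrank : {k m₁ m₂ m₃ : ℕ} →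
          (Fin k → Fin m₁) → (Fin k → Fin m₂) → (Fin k → Fin m₃) →
          ℤ → Set
IsCrank {k} π₁ π₂ π₃ r =
  ∃ λ d → IsMinGenSize π₁ π₂ π₃ d × r ≡ (+ (2 ℕ.* k)) ℤ.- (+ d)

-- Λ(c_π₁, c_π₂, c_π₃) is N / n^{2|A|}, where N counts the triples (x, y, z)
-- in L^A whose coordinates are constant on the cells of π₁, π₂, π₃.  Such a
-- triple is determined by its values on the cells of any generating set S:
-- two of them agree on a set of cells which contains S and, because any two
-- coordinates of a point of L determine the third, is closed; so they agree
-- everywhere.  Hence N ≤ n^{|S|}, and taking |S| minimal gives the bound.
module Submission where

open import Defs
open import Data.Bool using (Bool; true; false; T; not; _∧_; if_then_else_)
open import Data.Bool.Properties using (T-∧; T-≡)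
open import Data.Nat as ℕ using (ℕ; zero; suc; NonZero; _^_; z≤n; s≤s; compare; less; equal; greater)
import Data.Nat.Properties as ℕP
open import Data.Integer as ℤ using (ℤ; +_; -[1+_]; -_; _⊖_)
import Data.Integer.Properties as ℤP
open import Data.Rational using (ℚ; _≤_; 0ℚ; 1ℚ; _+_; _*_; _/_; toℚᵘ)
import Data.Rational.Properties as ℚP
import Data.Rational.Unnormalised as ℚᵘ
import Data.Rational.Unnormalised.Properties as ℚᵘP
open import Data.Fin using (Fin; _≟_)
import Data.Fin as Fin
open import Data.Fin.Properties using (all?)
open import Data.Fin.Subset using (Subset; _∈_; _⊆_; ∣_∣)
open import Data.Fin.Subset.Properties using (_∈?_)
open import Data.Maybe using (Maybe; just; nothing)
import Data.Maybe.Properties as MaybeP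
open import Data.List using (List; []; _∷_; [_]; _++_; length; map; concatMap; foldr; allFin; cartesianProductWith; cartesianProduct)
import Data.List.Properties as ListP
open import Data.List.Relation.Unary.All as All using (All; []; _∷_)
open import Data.List.Relation.Unary.AllPairs using ([]; _∷_)
open import Data.List.Relation.Unary.Any as Any using (Any)
import Data.List.Relation.Unary.Any.Properties as AnyP
open import Data.List.Membership.Propositional.Properties using (∈-allFin)
import Data.List.Relation.Unary.Unique.Setoid as UniqueSetoid
import Data.List.Relation.Unary.Unique.Setoid.Properties as UniqueP
open import Data.List.Relation.Unary.Unique.Propositional.Properties using (allFin⁺)
import Data.Vec as Vec
import Data.Vec.Properties as VecP
import Data.Vec.Functional as VF
open import Data.Product using (_×_; _,_; proj₁; proj₂; ∃!)
open import Data.Product.Relation.Binary.Pointwise.NonDependent using (_×ₛ_)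
open import Data.Empty using (⊥-elim)
open import Function using (_∘_; Equivalence)
open import Level using (0ℓ)
open import Relation.Binary using (Setoid)
open import Relation.Binary.PropositionalEquality hiding ([_])
open import Relation.Nullary using (Dec; does; ¬_; _×-dec_; _→-dec_)
open import Relation.Nullary.Decidable.Core using (isYes; T?)
open import Relation.Nullary.Decidable using (toWitness; fromWitness; toWitnessFalse; isYes≗does)

open Equivalence using (to; from)

count : {A : Set} → (A → Bool) → List A → ℕ
count p []       = 0
count p (a ∷ as) = if p a then suc (count p as) else count p as

module _ {A : Set} where

  count≡0 : (p : A → Bool) {xs : List A} → All (λ a → ¬ T (p a)) xs → count p xs ≡ 0
  count≡0 p []                      = refl
  count≡0 p {a ∷ _} (¬pa ∷ ¬pas) with p a
  ... | true  = ⊥-elim (¬pa _)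
  ... | false = count≡0 p ¬pas

  count-split : (p q : A → Bool) (xs : List A) →
    count p xs ≡ count (λ a → p a ∧ q a) xs ℕ.+ count (λ a → p a ∧ not (q a)) xs
  count-split p q []       = refl
  count-split p q (a ∷ as) with p a | q a
  ... | true  | true  = cong suc (count-split p q as)
  ... | true  | false = trans (cong suc (count-split p q as)) (sym (ℕP.+-suc _ _))
  ... | false | _     = count-split p q as

module _ (S : Setoid 0ℓ 0ℓ) where
  open Setoid S renaming (Carrier to A)
  open UniqueSetoid S using (Unique)

  count≤1 : (p : A → Bool) {xs : List A} → Unique xs →
    (∀ {a a'} → T (p a) → T (p a') → a ≈ a') → count p xs ℕ.≤ 1
  count≤1 p []            _       = z≤n
  count≤1 p {a ∷ _} (a∉as ∷ as!) related with p a in pa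
  ... | true  = s≤s (ℕP.≤-reflexive (count≡0 p
                  (All.map (λ a≉a' pa' → a≉a' (related (from T-≡ pa) pa')) a∉as)))
  ... | false = count≤1 p as! related

  -- Pigeonhole principle.
  module _ {B : Set} {Match : A → B → Set} (match? : ∀ a b → Dec (Match a b)) where

    count≤length : (p : A → Bool) {xs : List A} → Unique xs → (bs : List B) →
      (∀ {a a' b} → T (p a) → T (p a') → Match a b → Match a' b → a ≈ a') →
      (∀ {a} → T (p a) → Any (Match a) bs) →
      count p xs ℕ.≤ length bs
    count≤length p {xs} xs! [] _ matched =
      ℕP.≤-reflexive (count≡0 p {xs} (All.universal (λ a → AnyP.¬Any[] ∘ matched) _))
    count≤length p {xs} xs! (b ∷ bs) injective matched = begin
      count p xs                        ≡⟨ count-split p matchesB xs ⟩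
      count (λ a → p a ∧ matchesB a) xs
        ℕ.+ count (λ a → p a ∧ not (matchesB a)) xs
                                        ≤⟨ ℕP.+-mono-≤ (count≤1 _ xs! sameMatch)
                                             (count≤length _ xs! bs (λ q q' → injective (restricted q) (restricted q'))
                                               matchedByRest) ⟩
      suc (length bs)                   ∎
      where
      open ℕP.≤-Reasoning
      matchesB : A → Bool
      matchesB a = isYes (match? a b)
      sameMatch : ∀ {a a'} → T (p a ∧ matchesB a) → T (p a' ∧ matchesB a') → a ≈ a'
      sameMatch {a} {a'} q q' with to (T-∧ {p a} {matchesB a}) q | to (T-∧ {p a'} {matchesB a'}) q'
      ... | pa , ma | pa' , ma' = injective pa pa' (toWitness {a? = match? a b} ma) (toWitness {a? = match? a' b} ma')
      restricted : ∀ {a} → T (p a ∧ not (matchesB a)) → T (p a)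
      restricted {a} = proj₁ ∘ to (T-∧ {p a} {not (matchesB a)})
      matchedByRest : ∀ {a} → T (p a ∧ not (matchesB a)) → Any (Match a) bs
      matchedByRest {a} q with to (T-∧ {p a} {not (matchesB a)}) q
      ... | pa , ¬ma = Any.tail (toWitnessFalse {a? = match? a b} ¬ma) (matched pa)

module _ {A B C : Set} (f : A → B → C) where

  cartesianProductWith-concatMap : (xs : List A) (ys : List B) →
    cartesianProductWith f xs ys ≡ concatMap (λ x → map (f x) ys) xs
  cartesianProductWith-concatMap []       ys = refl
  cartesianProductWith-concatMap (x ∷ xs) ys = cong (map (f x) ys ++_) (cartesianProductWith-concatMap xs ys)

  length-cartesianProductWith : (xs : List A) (ys : List B) →
    length (cartesianProductWith f xs ys) ≡ length xs ℕ.* length ys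
  length-cartesianProductWith []       ys = refl
  length-cartesianProductWith (x ∷ xs) ys = begin
    length (map (f x) ys ++ cartesianProductWith f xs ys)      ≡⟨ ListP.length-++ (map (f x) ys) ⟩
    length (map (f x) ys) ℕ.+ length (cartesianProductWith f xs ys)
                                                               ≡⟨ cong₂ ℕ._+_ (ListP.length-map (f x) ys)
                                                                    (length-cartesianProductWith xs ys) ⟩
    length ys ℕ.+ length xs ℕ.* length ys                      ∎
    where open ≡-Reasoning

  map-cartesianProductWith : {D : Set} (g : C → D) (xs : List A) (ys : List B) →
    map g (cartesianProductWith f xs ys) ≡ concatMap (λ x → map (λ y → g (f x y)) ys) xs
  map-cartesianProductWith g []       ys = refl
  map-cartesianProductWith g (x ∷ xs) ys = begin
    map g (map (f x) ys ++ cartesianProductWith f xs ys)        ≡⟨ ListP.map-++ g (map (f x) ys) _ ⟩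
    map g (map (f x) ys) ++ map g (cartesianProductWith f xs ys) ≡⟨ cong₂ _++_ (sym (ListP.map-∘ ys))
                                                                     (map-cartesianProductWith g xs ys) ⟩
    map (g ∘ f x) ys ++ concatMap (λ x → map (λ y → g (f x y)) ys) xs ∎
    where open ≡-Reasoning

FunSetoid : ℕ → ℕ → Setoid 0ℓ 0ℓ
FunSetoid n k = Fin k →-setoid Fin n

allFuns-unique : ∀ n k → UniqueSetoid.Unique (FunSetoid n k) (allFuns n k)
allFuns-unique n zero    = [] ∷ []
allFuns-unique n (suc k) =
  subst (UniqueSetoid.Unique (FunSetoid n (suc k))) (cartesianProductWith-concatMap VF._∷_ (allFin n) (allFuns n k))
    (UniqueP.cartesianProductWith⁺ (setoid (Fin n)) (FunSetoid n k) (FunSetoid n (suc k)) VF._∷_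
      (λ eq → eq Fin.zero , eq ∘ Fin.suc) (allFin⁺ n) (allFuns-unique n k))

Triple : ℕ → ℕ → Set
Triple n k = (Fin k → Fin n) × (Fin k → Fin n) × (Fin k → Fin n)

TripleSetoid : ℕ → ℕ → Setoid 0ℓ 0ℓ
TripleSetoid n k = FunSetoid n k ×ₛ (FunSetoid n k ×ₛ FunSetoid n k)

triples : (n k : ℕ) → List (Triple n k)
triples n k = cartesianProduct (allFuns n k) (cartesianProduct (allFuns n k) (allFuns n k))

triples-unique : ∀ n k → UniqueSetoid.Unique (TripleSetoid n k) (triples n k)
triples-unique n k =
  UniqueP.cartesianProduct⁺ (FunSetoid n k) (FunSetoid n k ×ₛ FunSetoid n k) (allFuns-unique n k)
    (UniqueP.cartesianProduct⁺ (FunSetoid n k) (FunSetoid n k) (allFuns-unique n k) (allFuns-unique n k))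

map-triples : ∀ n k (g : Triple n k → ℚ) → let Fs = allFuns n k in
  map g (triples n k) ≡ concatMap (λ x → concatMap (λ y → map (λ z → g (x , y , z)) Fs) Fs) Fs
map-triples n k g =
  trans (map-cartesianProductWith _,_ g Fs (cartesianProduct Fs Fs))
    (ListP.concatMap-cong (λ x → map-cartesianProductWith _,_ (λ yz → g (x , yz)) Fs Fs) Fs)
  where Fs = allFuns n k

-- Values recorded on a set of cells

masks : (n : ℕ) {m : ℕ} → Subset m → List (Fin m → Maybe (Fin n))
masks n Vec.[]          = [ (λ ()) ]
masks n (true Vec.∷ S)  = cartesianProductWith (λ i b → just i VF.∷ b) (allFin n) (masks n S)
masks n (false Vec.∷ S) = map (nothing VF.∷_) (masks n S)

length-masks : ∀ n {m} (S : Subset m) → length (masks n S) ≡ n ^ ∣ S ∣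
length-masks n Vec.[]          = refl
length-masks n (true Vec.∷ S)  =
  trans (length-cartesianProductWith _ (allFin n) (masks n S))
    (cong₂ ℕ._*_ (ListP.length-tabulate {n = n} (λ i → i)) (length-masks n S))
length-masks n (false Vec.∷ S) = trans (ListP.length-map _ (masks n S)) (length-masks n S)

AgreesOn : {n m : ℕ} → Subset m → (Fin m → Maybe (Fin n)) → (Fin m → Fin n) → Set
AgreesOn S b g = ∀ j → j ∈ S → b j ≡ just (g j)

agreesOn? : {n m : ℕ} (S : Subset m) (b : Fin m → Maybe (Fin n)) (g : Fin m → Fin n) → Dec (AgreesOn S b g)
agreesOn? S b g = all? (λ j → (j ∈? S) →-dec MaybeP.≡-dec _≟_ (b j) (just (g j)))

masks-complete : ∀ n {m} (S : Subset m) (g : Fin m → Fin n) → Any (λ b → AgreesOn S b g) (masks n S)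
masks-complete n Vec.[]          g = Any.here (λ ())
masks-complete n (true Vec.∷ S)  g =
  AnyP.cartesianProductWith⁺ _ (λ { refl agrees → λ { Fin.zero Vec.here → refl
                                                    ; (Fin.suc j) (Vec.there j∈S) → agrees j j∈S } })
    (∈-allFin (g Fin.zero)) (masks-complete n S (g ∘ Fin.suc))
masks-complete n (false Vec.∷ S) g =
  AnyP.map⁺ (Any.map (λ agrees → λ { (Fin.suc j) (Vec.there j∈S) → agrees j j∈S })
    (masks-complete n S (g ∘ Fin.suc)))

∃!-unique : {A : Set} {P : A → Set} → ∃! _≡_ P → ∀ {a a'} → P a → P a' → a ≡ a'
∃!-unique (_ , _ , unique) pa pa' = trans (sym (unique pa)) (unique pa')

module _ {n : ℕ} {L : Fin n → Fin n → Fin n → Bool} (lat : IsLatinSquare n L) where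

  latin-determines₃ : ∀ {x y z x' y' z'} → L x y z ≡ true → L x' y' z' ≡ true → x ≡ x' → y ≡ y' → z ≡ z'
  latin-determines₃ {x} {y} l l' refl refl = ∃!-unique (proj₁ lat x y) l l'

  latin-determines₁ : ∀ {x y z x' y' z'} → L x y z ≡ true → L x' y' z' ≡ true → y ≡ y' → z ≡ z' → x ≡ x'
  latin-determines₁ {y = y} {z} l l' refl refl = ∃!-unique (proj₁ (proj₂ lat) y z) l l'

  latin-determines₂ : ∀ {x y z x' y' z'} → L x y z ≡ true → L x' y' z' ≡ true → z ≡ z' → x ≡ x' → y ≡ y'
  latin-determines₂ {x} {z = z} l l' refl refl = ∃!-unique (proj₂ (proj₂ lat) z x) l l'

rep : {k m : ℕ} {π : Fin k → Fin m} → IsPartition π → Fin m → Fin k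
rep P j = proj₁ (P j)

∈-tabulate⁺ : {m : ℕ} (f : Fin m → Bool) {j : Fin m} → T (f j) → j ∈ Vec.tabulate f
∈-tabulate⁺ f {j} fj = VecP.lookup⇒[]= j _ (trans (VecP.lookup∘tabulate f j) (to T-≡ fj))

∈-tabulate⁻ : {m : ℕ} (f : Fin m → Bool) {j : Fin m} → j ∈ Vec.tabulate f → T (f j)
∈-tabulate⁻ f {j} j∈ = from T-≡ (trans (sym (VecP.lookup∘tabulate f j)) (VecP.[]=⇒lookup j∈))

module _ {n k m : ℕ} {π : Fin k → Fin m} (P : IsPartition π) where

  agreementSet : (x x' : Fin k → Fin n) → Subset m
  agreementSet x x' = Vec.tabulate (λ j → isYes (x (rep P j) ≟ x' (rep P j)))

  ∈-agreementSet : ∀ x x' {j} → x (rep P j) ≡ x' (rep P j) → j ∈ agreementSet x x'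
  ∈-agreementSet x x' eq = ∈-tabulate⁺ _ (fromWitness eq)

  agreesOn⇒⊆agreementSet : ∀ {S b} x x' → AgreesOn S b (x ∘ rep P) → AgreesOn S b (x' ∘ rep P) →
    S ⊆ agreementSet x x'
  agreesOn⇒⊆agreementSet x x' agrees agrees' {j} j∈S =
    ∈-agreementSet x x' (MaybeP.just-injective (trans (sym (agrees j j∈S)) (agrees' j j∈S)))

  module _ {x x' : Fin k → Fin n} (x-const : ConstOnCells π x) (x'-const : ConstOnCells π x') where

    private
      at-rep : ∀ {u : Fin k → Fin n} → ConstOnCells π u → ∀ a → u a ≡ u (rep P (π a))
      at-rep u-const a = u-const a _ (sym (proj₂ (P (π a))))

    cell∈agreementSet : ∀ {a} → x a ≡ x' a → π a ∈ agreementSet x x'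
    cell∈agreementSet {a} eq = ∈-agreementSet x x' (trans (sym (at-rep x-const a)) (trans eq (at-rep x'-const a)))

    agreementSet-agree : ∀ {a} → π a ∈ agreementSet x x' → x a ≡ x' a
    agreementSet-agree {a} a∈ =
      trans (at-rep x-const a) (trans (toWitness (∈-tabulate⁻ _ a∈)) (sym (at-rep x'-const a)))

toℚᵘ-/ : ∀ i d .{{_ : NonZero d}} → toℚᵘ (i / d) ℚᵘ.≃ (i ℚᵘ./ d)
toℚᵘ-/ i (suc d) = ℚP.toℚᵘ-fromℚᵘ (ℚᵘ.mkℚᵘ i d)

[m/1]+[n/1] : ∀ m n → + m / 1 + + n / 1 ≡ + (m ℕ.+ n) / 1
[m/1]+[n/1] m n = ℚP.toℚᵘ-injective (begin-equality
  toℚᵘ (+ m / 1 + + n / 1)                  ≃⟨ ℚP.toℚᵘ-homo-+ (+ m / 1) (+ n / 1) ⟩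
  toℚᵘ (+ m / 1) ℚᵘ.+ toℚᵘ (+ n / 1)        ≃⟨ ℚᵘP.+-cong (toℚᵘ-/ (+ m) 1) (toℚᵘ-/ (+ n) 1) ⟩
  + m ℚᵘ./ 1 ℚᵘ.+ + n ℚᵘ./ 1                ≃⟨ ℚᵘ.*≡* (cong₂ ℤ._*_ (cong₂ ℤ._+_ (ℤP.*-identityʳ (+ m)) (ℤP.*-identityʳ (+ n))) refl) ⟩
  + (m ℕ.+ n) ℚᵘ./ 1                        ≃⟨ toℚᵘ-/ (+ (m ℕ.+ n)) 1 ⟨
  toℚᵘ (+ (m ℕ.+ n) / 1)                    ∎)
  where open ℚᵘP.≤-Reasoning

[m/1]*[1/d] : ∀ m d .{{_ : NonZero d}} → + m / 1 * (+ 1 / d) ≡ + m / d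
[m/1]*[1/d] m d@(suc d-1) = ℚP.toℚᵘ-injective (begin-equality
  toℚᵘ (+ m / 1 * (+ 1 / d))                ≃⟨ ℚP.toℚᵘ-homo-* (+ m / 1) (+ 1 / d) ⟩
  toℚᵘ (+ m / 1) ℚᵘ.* toℚᵘ (+ 1 / d)        ≃⟨ ℚᵘP.*-cong (toℚᵘ-/ (+ m) 1) (toℚᵘ-/ (+ 1) d) ⟩
  + m ℚᵘ./ 1 ℚᵘ.* (+ 1 ℚᵘ./ d)              ≃⟨ ℚᵘ.*≡* (cong₂ ℤ._*_ (ℤP.*-identityʳ (+ m)) (cong (λ e → + suc e) (sym (ℕP.+-identityʳ d-1)))) ⟩
  + m ℚᵘ./ d                                ≃⟨ toℚᵘ-/ (+ m) d ⟨
  toℚᵘ (+ m / d)                            ∎)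
  where open ℚᵘP.≤-Reasoning

[a/b]≤[c/d] : ∀ a b c d .{{_ : NonZero b}} .{{_ : NonZero d}} →
  a ℕ.* d ℕ.≤ c ℕ.* b → + a / b ≤ + c / d
[a/b]≤[c/d] a b@(suc _) c d@(suc _) ad≤cb = ℚP.toℚᵘ-cancel-≤ (begin
  toℚᵘ (+ a / b)  ≃⟨ toℚᵘ-/ (+ a) b ⟩
  + a ℚᵘ./ b      ≤⟨ ℚᵘ.*≤* (subst₂ ℤ._≤_ (ℤP.pos-* a d) (ℤP.pos-* c b) (ℤ.+≤+ ad≤cb)) ⟩
  + c ℚᵘ./ d      ≃⟨ toℚᵘ-/ (+ c) d ⟨
  toℚᵘ (+ c / d)  ∎)
  where open ℚᵘP.≤-Reasoning

m⊖[1+m+n]≡-[1+n] : ∀ m n → m ⊖ suc (m ℕ.+ n) ≡ -[1+ n ]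
m⊖[1+m+n]≡-[1+n] zero    n = refl
m⊖[1+m+n]≡-[1+n] (suc m) n = trans (ℤP.[1+m]⊖[1+n]≡m⊖n m (suc (m ℕ.+ n))) (m⊖[1+m+n]≡-[1+n] m n)

[1+m+n]⊖m≡+[1+n] : ∀ m n → suc (m ℕ.+ n) ⊖ m ≡ + suc n
[1+m+n]⊖m≡+[1+n] m n = trans (ℤP.⊖-swap (suc (m ℕ.+ n)) m) (cong -_ (m⊖[1+m+n]≡-[1+n] m n))

/≤ipow : ∀ n .{{_ : NonZero n}} {a} d e → a ℕ.≤ n ^ d →
  (+ a / n ^ e) {{ℕP.m^n≢0 n e}} ≤ ipow n (d ⊖ e)
/≤ipow n {a} d e a≤nᵈ = by-cases a≤nᵈ (compare d e)
  where
  open ℕP.≤-Reasoning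
  by-cases : ∀ {d e} → a ℕ.≤ n ^ d → ℕ.Ordering d e →
    (+ a / n ^ e) {{ℕP.m^n≢0 n e}} ≤ ipow n (d ⊖ e)
  by-cases a≤nᵈ (less d j) rewrite m⊖[1+m+n]≡-[1+n] d j =
    [a/b]≤[c/d] a (n ^ suc (d ℕ.+ j)) 1 (n ^ suc j) {{ℕP.m^n≢0 n (suc (d ℕ.+ j))}} {{ℕP.m^n≢0 n (suc j)}} (begin
    a ℕ.* n ^ suc j         ≤⟨ ℕP.*-monoˡ-≤ (n ^ suc j) a≤nᵈ ⟩
    n ^ d ℕ.* n ^ suc j     ≡⟨ ℕP.^-distribˡ-+-* n d (suc j) ⟨
    n ^ (d ℕ.+ suc j)       ≡⟨ cong (n ^_) (ℕP.+-suc d j) ⟩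
    n ^ suc (d ℕ.+ j)       ≡⟨ ℕP.*-identityˡ _ ⟨
    1 ℕ.* n ^ suc (d ℕ.+ j) ∎)
  by-cases a≤nᵈ (equal d) rewrite ℤP.n⊖n≡0 d =
    [a/b]≤[c/d] a (n ^ d) 1 1 {{ℕP.m^n≢0 n d}} (begin
    a ℕ.* 1                 ≡⟨ ℕP.*-identityʳ a ⟩
    a                       ≤⟨ a≤nᵈ ⟩
    n ^ d                   ≡⟨ ℕP.*-identityˡ _ ⟨
    1 ℕ.* n ^ d             ∎)
  by-cases a≤nᵈ (greater e j) rewrite [1+m+n]⊖m≡+[1+n] e j =
    [a/b]≤[c/d] a (n ^ e) (n ^ suc j) 1 {{ℕP.m^n≢0 n e}} (begin
    a ℕ.* 1                 ≡⟨ ℕP.*-identityʳ a ⟩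
    a                       ≤⟨ a≤nᵈ ⟩
    n ^ suc (e ℕ.+ j)       ≡⟨ cong (n ^_) (ℕP.+-suc e j) ⟨
    n ^ (e ℕ.+ suc j)       ≡⟨ ℕP.^-distribˡ-+-* n e (suc j) ⟩
    n ^ e ℕ.* n ^ suc j     ≡⟨ ℕP.*-comm (n ^ e) (n ^ suc j) ⟩
    n ^ suc j ℕ.* n ^ e     ∎)

𝟙 : Bool → ℚ
𝟙 b = if b then 1ℚ else 0ℚ

𝟙-∧ : ∀ b b' → 𝟙 b * 𝟙 b' ≡ 𝟙 (b ∧ b')
𝟙-∧ true  true  = refl
𝟙-∧ true  false = refl
𝟙-∧ false true  = refl
𝟙-∧ false false = refl

sumℚ-𝟙 : {A : Set} (p : A → Bool) (xs : List A) → sumℚ (map (𝟙 ∘ p) xs) ≡ + count p xs / 1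
sumℚ-𝟙 p []       = refl
sumℚ-𝟙 p (a ∷ as) with p a
... | true  = trans (cong (λ s → 1ℚ + s) (sumℚ-𝟙 p as)) ([m/1]+[n/1] 1 (count p as))
... | false = trans (ℚP.+-identityˡ _) (sumℚ-𝟙 p as)

-- The triples counted by Λ(c_π₁, c_π₂, c_π₃)

allB-sound : (k : ℕ) (p : Fin k → Bool) → T (allB k p) → ∀ a → T (p a)
allB-sound k p all-p a = All.lookup (foldr-sound (allFin k) all-p) (∈-allFin a)
  where
  foldr-sound : (xs : List (Fin k)) → T (foldr (λ a b → if p a then b else false) true xs) → All (T ∘ p) xs
  foldr-sound []       _ = []
  foldr-sound (a ∷ as) h with p a in pa
  ... | true = from T-≡ pa ∷ foldr-sound as h

module _ {n k m₁ m₂ m₃ : ℕ} (L : Fin n → Fin n → Fin n → Bool)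
         (π₁ : Fin k → Fin m₁) (π₂ : Fin k → Fin m₂) (π₃ : Fin k → Fin m₃) where

  InSupport : Triple n k → Set
  InSupport (x , y , z) = T (InLA L x y z) × (ConstOnCells π₁ x × ConstOnCells π₂ y) × ConstOnCells π₃ z

  inSupport? : ∀ t → Dec (InSupport t)
  inSupport? (x , y , z) =
    T? (InLA L x y z) ×-dec (constOnCells? π₁ x ×-dec constOnCells? π₂ y) ×-dec constOnCells? π₃ z

  inSupport : Triple n k → Bool
  inSupport = does ∘ inSupport?

  inSupport-sound : ∀ {t} → T (inSupport t) → InSupport t
  inSupport-sound {t} = toWitness ∘ subst T (sym (isYes≗does (inSupport? t)))

  Λ-count : .{{_ : NonZero n}} →
    Λ n k L (c π₁) (c π₂) (c π₃) ≡ (+ count inSupport (triples n k) / n ^ (2 ℕ.* k)) {{ℕP.m^n≢0 n (2 ℕ.* k)}}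
  Λ-count = begin
    Λ n k L (c π₁) (c π₂) (c π₃)                           ≡⟨ cong (λ s → sumℚ s * (+ 1 / M)) summands ⟩
    sumℚ (map (𝟙 ∘ inSupport) (triples n k)) * (+ 1 / M)     ≡⟨ cong (_* (+ 1 / M)) (sumℚ-𝟙 inSupport (triples n k)) ⟩
    + count inSupport (triples n k) / 1 * (+ 1 / M)           ≡⟨ [m/1]*[1/d] (count inSupport (triples n k)) M ⟩
    + count inSupport (triples n k) / M                       ∎
    where
    open ≡-Reasoning
    M = n ^ (2 ℕ.* k)
    instance _ = ℕP.m^n≢0 n (2 ℕ.* k)
    Fs = allFuns n k
    summand : ∀ b₀ b₁ b₂ b₃ → (if b₀ then 𝟙 b₁ * 𝟙 b₂ * 𝟙 b₃ else 0ℚ) ≡ 𝟙 (b₀ ∧ ((b₁ ∧ b₂) ∧ b₃))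
    summand false _  _  _  = refl
    summand true  b₁ b₂ b₃ = trans (cong (_* 𝟙 b₃) (𝟙-∧ b₁ b₂)) (𝟙-∧ (b₁ ∧ b₂) b₃)
    summands : concatMap (λ x → concatMap (λ y → map (λ z →
                 if InLA L x y z then c π₁ x * c π₂ y * c π₃ z else 0ℚ) Fs) Fs) Fs
               ≡ map (𝟙 ∘ inSupport) (triples n k)
    summands = trans
      (ListP.concatMap-cong (λ x → ListP.concatMap-cong (λ y → ListP.map-cong (λ z →
         summand (InLA L x y z)
           (does (constOnCells? π₁ x)) (does (constOnCells? π₂ y)) (does (constOnCells? π₃ z))) Fs) Fs) Fs)
      (sym (map-triples n k (𝟙 ∘ inSupport)))

  module _ (P₁ : IsPartition π₁) (P₂ : IsPartition π₂) (P₃ : IsPartition π₃) where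

    Code : Set
    Code = (Fin m₁ → Maybe (Fin n)) × (Fin m₂ → Maybe (Fin n)) × (Fin m₃ → Maybe (Fin n))

    Encodes : CellSubset m₁ m₂ m₃ → Triple n k → Code → Set
    Encodes S (x , y , z) (b₁ , b₂ , b₃) =
      AgreesOn (S₁ S) b₁ (x ∘ rep P₁) × AgreesOn (S₂ S) b₂ (y ∘ rep P₂) × AgreesOn (S₃ S) b₃ (z ∘ rep P₃)

    encodes? : ∀ S t b → Dec (Encodes S t b)
    encodes? S (x , y , z) (b₁ , b₂ , b₃) =
      agreesOn? (S₁ S) b₁ _ ×-dec agreesOn? (S₂ S) b₂ _ ×-dec agreesOn? (S₃ S) b₃ _

    codes : CellSubset m₁ m₂ m₃ → List Code
    codes S = cartesianProduct (masks n (S₁ S)) (cartesianProduct (masks n (S₂ S)) (masks n (S₃ S)))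

    length-codes : ∀ S → length (codes S) ≡ n ^ size S
    length-codes S = begin
      length (codes S)
        ≡⟨ length-cartesianProductWith _,_ (masks n (S₁ S)) _ ⟩
      length (masks n (S₁ S)) ℕ.* length (cartesianProduct (masks n (S₂ S)) (masks n (S₃ S)))
        ≡⟨ cong (length (masks n (S₁ S)) ℕ.*_) (length-cartesianProductWith _,_ (masks n (S₂ S)) _) ⟩
      length (masks n (S₁ S)) ℕ.* (length (masks n (S₂ S)) ℕ.* length (masks n (S₃ S)))
        ≡⟨ cong₂ ℕ._*_ (length-masks n (S₁ S)) (cong₂ ℕ._*_ (length-masks n (S₂ S)) (length-masks n (S₃ S))) ⟩
      n ^ ∣ S₁ S ∣ ℕ.* (n ^ ∣ S₂ S ∣ ℕ.* n ^ ∣ S₃ S ∣)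
        ≡⟨ ℕP.*-assoc (n ^ ∣ S₁ S ∣) _ _ ⟨
      n ^ ∣ S₁ S ∣ ℕ.* n ^ ∣ S₂ S ∣ ℕ.* n ^ ∣ S₃ S ∣
        ≡⟨ cong (ℕ._* n ^ ∣ S₃ S ∣) (ℕP.^-distribˡ-+-* n ∣ S₁ S ∣ ∣ S₂ S ∣) ⟨
      n ^ (∣ S₁ S ∣ ℕ.+ ∣ S₂ S ∣) ℕ.* n ^ ∣ S₃ S ∣
        ≡⟨ ℕP.^-distribˡ-+-* n (∣ S₁ S ∣ ℕ.+ ∣ S₂ S ∣) ∣ S₃ S ∣ ⟨
      n ^ size S ∎
      where open ≡-Reasoning

    codes-complete : ∀ S t → Any (Encodes S t) (codes S)
    codes-complete S (x , y , z) =
      AnyP.cartesianProduct⁺ (masks-complete n (S₁ S) _)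
        (AnyP.cartesianProduct⁺ (masks-complete n (S₂ S) _) (masks-complete n (S₃ S) _))

    agreementCells : Triple n k → Triple n k → CellSubset m₁ m₂ m₃
    agreementCells (x , y , z) (x' , y' , z') =
      ⟨ agreementSet P₁ x x' , agreementSet P₂ y y' , agreementSet P₃ z z' ⟩

    encodes⇒⊆agreementCells : ∀ {S t t' b} → Encodes S t b → Encodes S t' b → S ⊆c agreementCells t t'
    encodes⇒⊆agreementCells {t = x , y , z} {x' , y' , z'} (e₁ , e₂ , e₃) (e₁' , e₂' , e₃') =
        agreesOn⇒⊆agreementSet P₁ x x' e₁ e₁'
      , agreesOn⇒⊆agreementSet P₂ y y' e₂ e₂'
      , agreesOn⇒⊆agreementSet P₃ z z' e₃ e₃'

    fullAgreement⇒≈ : ∀ {t t'} → InSupport t → InSupport t' → IsFull (agreementCells t t') →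
      Setoid._≈_ (TripleSetoid n k) t t'
    fullAgreement⇒≈ (_ , (cx , cy) , cz) (_ , (cx' , cy') , cz') (full₁ , full₂ , full₃) =
        (λ a → agreementSet-agree P₁ cx cx' (full₁ (π₁ a)))
      , (λ a → agreementSet-agree P₂ cy cy' (full₂ (π₂ a)))
      , (λ a → agreementSet-agree P₃ cz cz' (full₃ (π₃ a)))

    agreementCells-closed : IsLatinSquare n L → ∀ {t t'} → InSupport t → InSupport t' →
      Closed π₁ π₂ π₃ (agreementCells t t')
    agreementCells-closed lat {x , y , z} {x' , y' , z'} (inL , (cx , cy) , cz) (inL' , (cx' , cy') , cz') a =
        (λ x≡ y≡ → cell∈agreementSet P₃ cz cz'
                     (latin-determines₃ lat l l' (agreementSet-agree P₁ cx cx' x≡) (agreementSet-agree P₂ cy cy' y≡)))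
      , (λ y≡ z≡ → cell∈agreementSet P₁ cx cx'
                     (latin-determines₁ lat l l' (agreementSet-agree P₂ cy cy' y≡) (agreementSet-agree P₃ cz cz' z≡)))
      , (λ z≡ x≡ → cell∈agreementSet P₂ cy cy'
                     (latin-determines₂ lat l l' (agreementSet-agree P₃ cz cz' z≡) (agreementSet-agree P₁ cx cx' x≡)))
      where
      l  = to T-≡ (allB-sound k _ inL a)
      l' = to T-≡ (allB-sound k _ inL' a)

    count-inSupport≤n^size : IsLatinSquare n L → ∀ {S} → Generates π₁ π₂ π₃ S →
      count inSupport (triples n k) ℕ.≤ n ^ size S
    count-inSupport≤n^size lat {S} generates = begin
      count inSupport (triples n k)
        ≤⟨ count≤length (TripleSetoid n k) (encodes? S) inSupport (triples-unique n k) (codes S)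
             encoding-injective (λ {t} _ → codes-complete S t) ⟩
      length (codes S)
        ≡⟨ length-codes S ⟩
      n ^ size S ∎
      where
      open ℕP.≤-Reasoning
      encoding-injective : ∀ {t t' b} → T (inSupport t) → T (inSupport t') →
        Encodes S t b → Encodes S t' b → Setoid._≈_ (TripleSetoid n k) t t'
      encoding-injective {t} {t'} t∈ t'∈ e e' =
        fullAgreement⇒≈ (inSupport-sound t∈) (inSupport-sound t'∈)
          (generates (agreementCells t t') (agreementCells-closed lat (inSupport-sound t∈) (inSupport-sound t'∈))
            (encodes⇒⊆agreementCells {S} {t} {t'} e e'))

lemma3p2 : (n k m₁ m₂ m₃ : ℕ) .{{_ : NonZero n}}
    (L : Fin n → Fin n → Fin n → Bool) → IsLatinSquare n L →
    (π₁ : Fin k → Fin m₁) (π₂ : Fin k → Fin m₂) (π₃ : Fin k → Fin m₃) →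
    IsPartition π₁ → IsPartition π₂ → IsPartition π₃ →
    (r : ℤ) → IsCrank π₁ π₂ π₃ r →
    (0ℚ ≤ Λ n k L (c π₁) (c π₂) (c π₃))
      × (Λ n k L (c π₁) (c π₂) (c π₃) ≤ ipow n (- r))
-- Any generating set gives the bound.
lemma3p2 n k m₁ m₂ m₃ L lat π₁ π₂ π₃ P₁ P₂ P₃ r (d , ((S , generates , refl) , _) , refl) =
    subst (0ℚ ≤_) (sym Λ≡) ([a/b]≤[c/d] 0 1 N (n ^ (2 ℕ.* k)) {{_}} {{ℕP.m^n≢0 n (2 ℕ.* k)}} z≤n)
  , subst₂ _≤_ (sym Λ≡) (cong (ipow n) (sym -r≡))
      (/≤ipow n (size S) (2 ℕ.* k) (count-inSupport≤n^size L π₁ π₂ π₃ P₁ P₂ P₃ lat generates))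
  where
  N  = count (inSupport L π₁ π₂ π₃) (triples n k)
  Λ≡ = Λ-count L π₁ π₂ π₃
  -r≡ : - (+ (2 ℕ.* k) ℤ.- + size S) ≡ size S ⊖ 2 ℕ.* k
  -r≡ = trans (cong -_ (ℤP.[+m]-[+n]≡m⊖n (2 ℕ.* k) (size S))) (sym (ℤP.⊖-swap (size S) (2 ℕ.* k)))
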